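{- Let $D$ be a digraph. Then $\zeta(U_D)$ equals the number of hamps of $\overline{D}$.
   Context: A digraph is $D=(V,A)$ with $V$ finite, $n=|V|$, $A\subseteq V\times V$; $\overline{D}=(V,(V\times V)\setminus A)$. A $V$-listing is a tuple $w=(w_1,\dots,w_n)$ containing each element of $V$ exactly once; $\operatorname{Des}(w,D)=\{i\in[n-1]:(w_i,w_{i+1})\in A\}$; $L_{I,n}=\sum x_{i_1}\cdots x_{i_n}$ over positive integers $i_1\le\cdots\le i_n$ with $i_p<i_{p+1}$ for $p\in I$; $U_D=\sum_w L_{\operatorname{Des}(w,D),n}$ over all $V$-listings. $\zeta$ is the ring homomorphism from quasisymmetric functions to $\mathbb{Z}$ sending $f$ to $f(1,0,0,\dots)$ (set $x_1=1$ and all other $x_i=0$). For a digraph $E=(V,B)$ an $E$-path is a nonempty tuple $v=(v_1,\dots,v_k)$ of distinct elements of $V$ with $(v_i,v_{i+1})\in B$ for all $i\in[k-1]$, and a hamp of $E$ is an $E$-path containing every vertex; by convention, when $V=\varnothing$ the empty list counts as a hamp. -}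

module Defs where

open import Data.Nat as ℕ using (ℕ; zero; suc; _≤_; _<_; _≤?_; _<?_)
open import Data.Fin using (Fin; toℕ)
open import Data.Fin.Properties using (all?) renaming (_≟_ to _≟F_)
open import Data.Nat.Properties using () renaming (_≟_ to _≟ℕ_)
open import Data.Bool using (Bool; true; false; not; if_then_else_)
open import Data.List using (List; []; _∷_; map; concatMap; filter; length; allFin; upTo; foldr)
open import Data.List.Membership.Propositional using (_∈_)
import Data.List.Membership.DecPropositional as MemDec
open import Data.List.Relation.Unary.Unique.Propositional using (Unique)
import Data.List.Relation.Unary.Unique.DecPropositional as UniqDec
open import Data.Integer as ℤ using (ℤ)
open import Data.Product using (_×_)
open import Data.Sum using (_⊎_)
open import Data.Unit using (⊤)
open import Data.Empty using (⊥)
open import Relation.Nullary using (Dec; yes; no; does; ¬_)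
open import Relation.Nullary.Decidable using (_×-dec_; _⊎-dec_)
open import Relation.Binary.PropositionalEquality using (_≡_)

record Digraph (n : ℕ) : Set where
  constructor digraph
  field
    arc : Fin n → Fin n → Bool
open Digraph public

complement : ∀ {n} → Digraph n → Digraph n
complement D = digraph (λ u v → not (arc D u v))

listsOf : ∀ {a} {A : Set a} → List A → ℕ → List (List A)
listsOf xs zero    = [] ∷ []
listsOf xs (suc k) = concatMap (λ x → map (x ∷_) (listsOf xs k)) xs

sumℤ : List ℤ → ℤ
sumℤ = foldr ℤ._+_ (ℤ.+ 0)

productℤ : List ℤ → ℤ
productℤ = foldr ℤ._*_ (ℤ.+ 1)

IsListing : (n : ℕ) → List (Fin n) → Set
IsListing n w = (length w ≡ n) × (Unique w × (∀ v → v ∈ w))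

isListing? : (n : ℕ) (w : List (Fin n)) → Dec (IsListing n w)
isListing? n w =
  (length w ≟ℕ n) ×-dec (UniqDec.unique? _≟F_ w ×-dec all? (λ v → MemDec._∈?_ _≟F_ v w))

listings : (n : ℕ) → List (List (Fin n))
listings n = filter (isListing? n) (listsOf (allFin n) n)

-- Descent set  Des(w, D) = { i ∈ [n-1] : (w_i, w_{i+1}) ∈ A }
-- (positions are 1-based; desFrom i w lists positions starting at i)

desFrom : ∀ {n} → Digraph n → ℕ → List (Fin n) → List ℕ
desFrom D i []            = []
desFrom D i (a ∷ [])      = []
desFrom D i (a ∷ b ∷ w)   =
  if arc D a b then i ∷ desFrom D (suc i) (b ∷ w) else desFrom D (suc i) (b ∷ w)

Des : ∀ {n} → List (Fin n) → Digraph n → List ℕ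
Des w D = desFrom D 1 w

-- Fundamental quasisymmetric function L_{I,n}, evaluated at a point
-- x = (x_1, …, x_m, 0, 0, …) whose coordinates vanish beyond index m.
-- Variable x_{j+1} is  x j  for j : Fin m.  Since x_i = 0 for i > m, only
-- index sequences with values in [m] contribute, so
--   L_{I,n}(x) = Σ_{i_1 ≤ … ≤ i_n in [m], i_p < i_{p+1} for p ∈ I} x_{i_1}⋯x_{i_n}.

Admissible : ∀ {m} → List ℕ → ℕ → List (Fin m) → Set
Admissible I p []          = ⊤
Admissible I p (a ∷ [])    = ⊤
Admissible I p (a ∷ b ∷ s) =
  ((p ∈ I × toℕ a < toℕ b) ⊎ (¬ (p ∈ I) × toℕ a ≤ toℕ b)) × Admissible I (suc p) (b ∷ s)

admissible? : ∀ {m} (I : List ℕ) (p : ℕ) (s : List (Fin m)) → Dec (Admissible I p s)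
admissible? I p []          = yes _
admissible? I p (a ∷ [])    = yes _
admissible? I p (a ∷ b ∷ s) =
  ((pI ×-dec (toℕ a <? toℕ b)) ⊎-dec (notPI ×-dec (toℕ a ≤? toℕ b)))
    ×-dec admissible? I (suc p) (b ∷ s)
  where
  pI : Dec (p ∈ I)
  pI = MemDec._∈?_ _≟ℕ_ p I
  notPI : Dec (¬ (p ∈ I))
  notPI with pI
  ... | yes q = no (λ f → f q)
  ... | no  q = yes q

evalL : (m : ℕ) → (Fin m → ℤ) → List ℕ → (n : ℕ) → ℤ
evalL m x I n = sumℤ (map (λ s → productℤ (map x s))
                          (filter (admissible? I 1) (listsOf (allFin m) n)))

evalU : ∀ {n} → (m : ℕ) → (Fin m → ℤ) → Digraph n → ℤ
evalU {n} m x D = sumℤ (map (λ w → evalL m x (Des w D) n) (listings n))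

-- ζ : set x_1 = 1 and x_i = 0 for all i ≥ 2.  Computed via the point
-- (1, 0, …, 0) with m + 1 nonzero-allowed coordinates (any m gives ζ).
ζpoint : (m : ℕ) → Fin (suc m) → ℤ
ζpoint m Fin.zero    = ℤ.+ 1
ζpoint m (Fin.suc _) = ℤ.+ 0

ζU : ∀ {n} → (m : ℕ) → Digraph n → ℤ
ζU m D = evalU (suc m) (ζpoint m) D

Consecutive : ∀ {n} → Digraph n → List (Fin n) → Set
Consecutive E []          = ⊤
Consecutive E (a ∷ [])    = ⊤
Consecutive E (a ∷ b ∷ v) = (arc E a b ≡ true) × Consecutive E (b ∷ v)

consecutive? : ∀ {n} (E : Digraph n) (v : List (Fin n)) → Dec (Consecutive E v)
consecutive? E []          = yes _
consecutive? E (a ∷ [])    = yes _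
consecutive? E (a ∷ b ∷ v) = (arc E a b Data.Bool.≟ true) ×-dec consecutive? E (b ∷ v)

NonEmpty : ∀ {a} {A : Set a} → List A → Set
NonEmpty []      = ⊥
NonEmpty (_ ∷ _) = ⊤

nonEmpty? : ∀ {a} {A : Set a} (v : List A) → Dec (NonEmpty v)
nonEmpty? []      = no (λ ())
nonEmpty? (_ ∷ _) = yes _

IsPath : ∀ {n} → Digraph n → List (Fin n) → Set
IsPath E v = NonEmpty v × (Unique v × Consecutive E v)

IsHamp : ∀ {n} → Digraph n → List (Fin n) → Set
IsHamp {n} E v = (IsPath E v × (∀ u → u ∈ v)) ⊎ ((n ≡ 0) × (v ≡ []))

isHamp? : ∀ {n} (E : Digraph n) (v : List (Fin n)) → Dec (IsHamp E v)
isHamp? {n} E v =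
  ((nonEmpty? v ×-dec (UniqDec.unique? _≟F_ v ×-dec consecutive? E v))
     ×-dec all? (λ u → MemDec._∈?_ _≟F_ u v))
  ⊎-dec ((n ≟ℕ 0) ×-dec emptyDec v)
  where
  emptyDec : (v : List (Fin n)) → Dec (v ≡ [])
  emptyDec []      = yes _≡_.refl
  emptyDec (_ ∷ _) = no (λ ())

-- Number of hamps of E.  A tuple of distinct elements of V has length at
-- most n = |V|, so enumerating all tuples of lengths 0, 1, …, n covers
-- every candidate.
numHamps : ∀ {n} → Digraph n → ℕ
numHamps {n} E =
  foldr ℕ._+_ 0 (map (λ k → length (filter (isHamp? E) (listsOf (allFin n) k))) (upTo (suc n)))

-- Setting x₁ = 1 and xᵢ = 0 for i ≥ 2 in L_{I,n} leaves only the index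
-- sequence (1, 1, …, 1), which is admissible iff I ∩ [n-1] = ∅.  Hence
-- ζ(L_{Des(w,D),n}) is 1 exactly when no two consecutive entries of w form
-- an arc of D, i.e. when the listing w is a path, and therefore a hamp, of
-- D̄; summing over all listings counts the hamps of D̄.
module Submission where

open import Defs
open import Data.Nat using (ℕ)
open import Data.Integer using (+_)
open import Relation.Binary.PropositionalEquality using (_≡_)

open import Data.Bool using (Bool; true; false; if_then_else_)
open import Data.Empty using (⊥-elim)
open import Data.Fin using (Fin; zero; suc)
open import Data.Fin.Properties using (injective⇒≤)
open import Data.Integer using (ℤ) renaming (_+_ to _+ℤ_)
import Data.Integer.Properties as ℤ
open import Data.List
  using (List; []; _∷_; [_]; _++_; _∷ʳ_; map; concatMap; filter; length; allFin; tabulate; upTo; replicate; lookup)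
open import Data.List.Properties
  using (map-++; map-∘; applyUpTo-∷ʳ; ∷-injectiveʳ; filter-none)
open import Data.List.Membership.Propositional using (_∈_)
open import Data.List.Relation.Unary.All as All using (All; []; _∷_)
open import Data.List.Relation.Unary.All.Properties using (all-upTo; concat⁺; map⁺; tabulate⁺)
open import Data.List.Relation.Unary.AllPairs using ([])
open import Data.List.Relation.Unary.Any as Any using (here)
open import Data.List.Relation.Unary.Any.Properties using (lookup-index)
open import Data.Nat using (_≤_; _<_; z≤n)
import Data.Nat as ℕ
import Data.Nat.Properties as ℕ
open import Data.Nat.ListAction using (sum)
open import Data.Nat.ListAction.Properties using (sum-++)
open import Data.Product using (_,_)
open import Data.Sum using (_⊎_; inj₁; inj₂)
open import Data.Unit using (tt)
open import Function using (_∘_; id; _⇔_; mk⇔)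
open import Function.Construct.Composition using (_⇔-∘_)
open import Function.Construct.Symmetry using (⇔-sym)
open import Relation.Nullary using (Dec; yes; no; does; ¬_)
open import Relation.Nullary.Decidable using (does-⇔; dec-false)
open import Relation.Unary using (Pred; Decidable)
open import Relation.Binary.PropositionalEquality using (refl; sym; trans; cong; cong₂; subst; module ≡-Reasoning)

open ≡-Reasoning

private
  variable
    A B : Set

sumℤ-++ : (xs ys : List ℤ) → sumℤ (xs ++ ys) ≡ sumℤ xs +ℤ sumℤ ys
sumℤ-++ []       ys = sym (ℤ.+-identityˡ _)
sumℤ-++ (x ∷ xs) ys = trans (cong (x +ℤ_) (sumℤ-++ xs ys)) (sym (ℤ.+-assoc x _ _))

sumℤ-map-concatMap : (h : B → ℤ) (g : A → List B) (xs : List A) →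
  sumℤ (map h (concatMap g xs)) ≡ sumℤ (map (sumℤ ∘ map h ∘ g) xs)
sumℤ-map-concatMap h g []       = refl
sumℤ-map-concatMap h g (x ∷ xs) = begin
  sumℤ (map h (g x ++ concatMap g xs))              ≡⟨ cong sumℤ (map-++ h (g x) _) ⟩
  sumℤ (map h (g x) ++ map h (concatMap g xs))      ≡⟨ sumℤ-++ (map h (g x)) _ ⟩
  sumℤ (map h (g x)) +ℤ sumℤ (map h (concatMap g xs))
    ≡⟨ cong (sumℤ (map h (g x)) +ℤ_) (sumℤ-map-concatMap h g xs) ⟩
  sumℤ (map h (g x)) +ℤ sumℤ (map (sumℤ ∘ map h ∘ g) xs) ∎

sumℤ-map-cong : {f g : A → ℤ} {xs : List A} → All (λ x → f x ≡ g x) xs →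
  sumℤ (map f xs) ≡ sumℤ (map g xs)
sumℤ-map-cong []       = refl
sumℤ-map-cong (e ∷ es) = cong₂ _+ℤ_ e (sumℤ-map-cong es)

sumℤ-map-≡0 : {f : A → ℤ} {xs : List A} → All (λ x → f x ≡ + 0) xs → sumℤ (map f xs) ≡ + 0
sumℤ-map-≡0 []       = refl
sumℤ-map-≡0 (e ∷ es) = cong₂ _+ℤ_ e (sumℤ-map-≡0 es)

sumℤ-map-filter : ∀ {p} {P : Pred A p} (P? : Decidable P) (f : A → ℤ) (xs : List A) →
  sumℤ (map f (filter P? xs)) ≡ sumℤ (map (λ x → if does (P? x) then f x else + 0) xs)
sumℤ-map-filter P? f []       = refl
sumℤ-map-filter P? f (x ∷ xs) with does (P? x)
... | true  = cong (f x +ℤ_) (sumℤ-map-filter P? f xs)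
... | false = trans (sumℤ-map-filter P? f xs) (sym (ℤ.+-identityˡ _))

sumℤ-map-const-1 : (xs : List A) → sumℤ (map (λ _ → + 1) xs) ≡ + length xs
sumℤ-map-const-1 []       = refl
sumℤ-map-const-1 (x ∷ xs) = cong (+ 1 +ℤ_) (sumℤ-map-const-1 xs)

𝟙 : Bool → ℤ
𝟙 b = if b then + 1 else + 0

sumℤ-count : ∀ {p} {P : Pred A p} (P? : Decidable P) (xs : List A) →
  sumℤ (map (𝟙 ∘ does ∘ P?) xs) ≡ + length (filter P? xs)
sumℤ-count P? xs = trans (sym (sumℤ-map-filter P? _ xs)) (sumℤ-map-const-1 (filter P? xs))

sum-map-≡0 : {f : A → ℕ} {xs : List A} → All (λ x → f x ≡ 0) xs → sum (map f xs) ≡ 0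
sum-map-≡0 []       = refl
sum-map-≡0 (e ∷ es) = cong₂ ℕ._+_ e (sum-map-≡0 es)

sum-map-upTo-suc : (f : ℕ → ℕ) (n : ℕ) → (∀ {k} → k < n → f k ≡ 0) →
  sum (map f (upTo (ℕ.suc n))) ≡ f n
sum-map-upTo-suc f n vanish = begin
  sum (map f (upTo (ℕ.suc n)))            ≡⟨ cong (sum ∘ map f) (sym (applyUpTo-∷ʳ id n)) ⟩
  sum (map f (upTo n ∷ʳ n))               ≡⟨ cong sum (map-++ f (upTo n) [ n ]) ⟩
  sum (map f (upTo n) ++ [ f n ])         ≡⟨ sum-++ (map f (upTo n)) [ f n ] ⟩
  sum (map f (upTo n)) ℕ.+ (f n ℕ.+ 0)    ≡⟨ cong₂ ℕ._+_ (sum-map-≡0 (All.map vanish (all-upTo n))) (ℕ.+-identityʳ (f n)) ⟩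
  f n                                     ∎

length-listsOf : (xs : List A) (k : ℕ) → All (λ w → length w ≡ k) (listsOf xs k)
length-listsOf xs ℕ.zero    = refl ∷ []
length-listsOf xs (ℕ.suc k) =
  concat⁺ (map⁺ (All.universal (λ _ → map⁺ (All.map (cong ℕ.suc) (length-listsOf xs k))) xs))

covering-length : ∀ {n} (v : List (Fin n)) → (∀ u → u ∈ v) → n ≤ length v
covering-length v covers = injective⇒≤ {f = λ u → Any.index (covers u)} index-injective
  where
  index-injective : ∀ {x y} → Any.index (covers x) ≡ Any.index (covers y) → x ≡ y
  index-injective {x} {y} e =
    trans (lookup-index (covers x)) (trans (cong (lookup v) e) (sym (lookup-index (covers y))))

-- zeros k encodes the index sequence (1, …, 1): the index i : Fin m stands for x_{i+1}.
zeros : ∀ {M} → ℕ → List (Fin (ℕ.suc M))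
zeros k = replicate k zero

SupportedOnZeros : ∀ {M} → (List (Fin (ℕ.suc M)) → ℤ) → Set
SupportedOnZeros h = ∀ s → h s ≡ + 0 ⊎ s ≡ zeros (length s)

sumℤ-listsOf-zeros : ∀ {M} (k : ℕ) (h : List (Fin (ℕ.suc M)) → ℤ) → SupportedOnZeros h →
  sumℤ (map h (listsOf (allFin (ℕ.suc M)) k)) ≡ h (zeros k)
sumℤ-listsOf-zeros ℕ.zero    h supported = ℤ.+-identityʳ _
sumℤ-listsOf-zeros {M} (ℕ.suc k) h supported = begin
  sumℤ (map h (listsOf (allFin (ℕ.suc M)) (ℕ.suc k)))
    ≡⟨ sumℤ-map-concatMap h (λ x → map (x ∷_) Ws) (allFin (ℕ.suc M)) ⟩
  sumℤ (map h (map (zero ∷_) Ws)) +ℤ sumℤ (map (λ i → sumℤ (map h (map (i ∷_) Ws))) (tabulate suc))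
    ≡⟨ cong₂ _+ℤ_ (cong sumℤ (sym (map-∘ Ws))) (sumℤ-map-≡0 (tabulate⁺ vanish-at-suc)) ⟩
  sumℤ (map (h ∘ (zero ∷_)) Ws) +ℤ + 0
    ≡⟨ ℤ.+-identityʳ _ ⟩
  sumℤ (map (h ∘ (zero ∷_)) Ws)
    ≡⟨ sumℤ-listsOf-zeros k (h ∘ (zero ∷_)) supported-tail ⟩
  h (zeros (ℕ.suc k)) ∎
  where
  Ws : List (List (Fin (ℕ.suc M)))
  Ws = listsOf (allFin (ℕ.suc M)) k
  vanish-at-suc : (i : Fin M) → sumℤ (map h (map (suc i ∷_) Ws)) ≡ + 0
  vanish-at-suc i = sumℤ-map-≡0 (map⁺ (All.universal vanish Ws))
    where
    vanish : ∀ t → h (suc i ∷ t) ≡ + 0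
    vanish t with supported (suc i ∷ t)
    ... | inj₁ e = e
  supported-tail : SupportedOnZeros (h ∘ (zero ∷_))
  supported-tail t with supported (zero ∷ t)
  ... | inj₁ e = inj₁ e
  ... | inj₂ e = inj₂ (∷-injectiveʳ e)

ζ-product : ∀ {M} → List (Fin (ℕ.suc M)) → ℤ
ζ-product {M} s = productℤ (map (ζpoint M) s)

ζ-product-supported : ∀ {M} → SupportedOnZeros (ζ-product {M})
ζ-product-supported []          = inj₂ refl
ζ-product-supported (zero ∷ s)  with ζ-product-supported s
... | inj₁ e = inj₁ (trans (ℤ.*-identityˡ _) e)
... | inj₂ e = inj₂ (cong (zero ∷_) e)
ζ-product-supported (suc i ∷ s) = inj₁ (ℤ.*-zeroˡ (ζ-product s))

ζ-product-zeros : ∀ {M} (k : ℕ) → ζ-product {M} (zeros k) ≡ + 1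
ζ-product-zeros ℕ.zero    = refl
ζ-product-zeros (ℕ.suc k) = trans (ℤ.*-identityˡ _) (ζ-product-zeros k)

evalL-ζpoint : ∀ M (I : List ℕ) (k : ℕ) →
  evalL (ℕ.suc M) (ζpoint M) I k ≡ 𝟙 (does (admissible? I 1 (zeros {M} k)))
evalL-ζpoint M I k = begin
  evalL (ℕ.suc M) (ζpoint M) I k
    ≡⟨ sumℤ-map-filter (admissible? I 1) ζ-product (listsOf (allFin (ℕ.suc M)) k) ⟩
  sumℤ (map h (listsOf (allFin (ℕ.suc M)) k))
    ≡⟨ sumℤ-listsOf-zeros k h h-supported ⟩
  h (zeros k)
    ≡⟨ cong (λ z → if does (admissible? I 1 (zeros k)) then z else + 0) (ζ-product-zeros k) ⟩
  𝟙 (does (admissible? I 1 (zeros {M} k))) ∎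
  where
  h : List (Fin (ℕ.suc M)) → ℤ
  h s = if does (admissible? I 1 s) then ζ-product s else + 0
  h-supported : SupportedOnZeros h
  h-supported s with ζ-product-supported s | does (admissible? I 1 s)
  ... | inj₂ e | _     = inj₂ e
  ... | inj₁ e | true  = inj₁ e
  ... | inj₁ e | false = inj₁ refl

module _ {n : ℕ} (D : Digraph n) where

  desFrom-lowerBound : ∀ p (w : List (Fin n)) → All (p ≤_) (desFrom D p w)
  desFrom-lowerBound p []              = []
  desFrom-lowerBound p (a ∷ [])        = []
  desFrom-lowerBound p (a ∷ w@(b ∷ _))
    with All.map ℕ.<⇒≤ (desFrom-lowerBound (ℕ.suc p) w) | arc D a b
  ... | later | true  = ℕ.≤-refl ∷ later
  ... | later | false = later

  -- The constant sequence satisfies every weak inequality and no strict one.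
  admissible-zeros⇔consecutive : ∀ {M} p (w : List (Fin n)) →
    Admissible (desFrom D p w) p (zeros {M} (length w)) ⇔ Consecutive (complement D) w
  admissible-zeros⇔consecutive p w = mk⇔ (admissible⇒ p w) (⇒admissible p w)
    where
    admissible⇒ : ∀ p w → Admissible (desFrom D p w) p (zeros (length w)) → Consecutive (complement D) w
    admissible⇒ p []              _ = tt
    admissible⇒ p (a ∷ [])        _ = tt
    admissible⇒ p (a ∷ w@(b ∷ _)) adm with admissible⇒ (ℕ.suc p) w | arc D a b
    admissible⇒ p (a ∷ w@(b ∷ _)) (inj₁ (_ , ()) , _)  | _  | true
    admissible⇒ p (a ∷ w@(b ∷ _)) (inj₂ (p∉ , _) , _)  | _  | true  = ⊥-elim (p∉ (here refl))
    admissible⇒ p (a ∷ w@(b ∷ _)) (_ , adm)            | ih | false = refl , ih adm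

    ⇒admissible : ∀ p w → Consecutive (complement D) w → Admissible (desFrom D p w) p (zeros (length w))
    ⇒admissible p []              _ = tt
    ⇒admissible p (a ∷ [])        _ = tt
    ⇒admissible p (a ∷ w@(b ∷ _)) consec
      with ⇒admissible (ℕ.suc p) w | desFrom-lowerBound (ℕ.suc p) w | arc D a b
    ⇒admissible p (a ∷ w@(b ∷ _)) (() , _)     | _  | _       | true
    ⇒admissible p (a ∷ w@(b ∷ _)) (_ , consec) | ih | later>p | false =
      inj₂ ((λ p∈ → ℕ.<-irrefl refl (All.lookup later>p p∈)) , z≤n) , ih consec

module _ {n : ℕ} (E : Digraph n) where

  hamp⇒≤length : {v : List (Fin n)} → IsHamp E v → n ≤ length v
  hamp⇒≤length (inj₁ (_ , covers)) = covering-length _ covers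
  hamp⇒≤length (inj₂ (refl , _))   = z≤n

  hamp⇒listing : {v : List (Fin n)} → length v ≡ n → IsHamp E v → IsListing n v
  hamp⇒listing len (inj₁ ((_ , unique , _) , covers)) = len , unique , covers
  hamp⇒listing len (inj₂ (refl , refl))                = refl , [] , λ ()

  listing⇒hamp⇔consecutive : {v : List (Fin n)} → IsListing n v → IsHamp E v ⇔ Consecutive E v
  listing⇒hamp⇔consecutive {[]}    (len , _ , _) = mk⇔ (λ _ → tt) (λ _ → inj₂ (sym len , refl))
  listing⇒hamp⇔consecutive {_ ∷ _} (_ , unique , covers) =
    mk⇔ (λ { (inj₁ ((_ , _ , consec) , _)) → consec ; (inj₂ (_ , ())) })
        (λ consec → inj₁ ((tt , unique , consec) , covers))

  numHamps≡count : numHamps E ≡ length (filter (isHamp? E) (listsOf (allFin n) n))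
  numHamps≡count = sum-map-upTo-suc hampsOfLength n no-short-hamps
    where
    hampsOfLength : ℕ → ℕ
    hampsOfLength k = length (filter (isHamp? E) (listsOf (allFin n) k))
    no-short-hamps : ∀ {k} → k < n → hampsOfLength k ≡ 0
    no-short-hamps k<n =
      cong length (filter-none (isHamp? E) (All.map not-hamp (length-listsOf (allFin n) _)))
      where
      not-hamp : ∀ {v} → length v ≡ _ → ¬ IsHamp E v
      not-hamp len hamp = ℕ.<⇒≱ k<n (subst (n ≤_) len (hamp⇒≤length hamp))

module _ {n : ℕ} (D : Digraph n) (M : ℕ) where

  evalL-ζpoint-Des : {w : List (Fin n)} → IsListing n w →
    evalL (ℕ.suc M) (ζpoint M) (Des w D) n ≡ 𝟙 (does (isHamp? (complement D) w))
  evalL-ζpoint-Des {w} listing@(len , _) =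
    trans (evalL-ζpoint M (Des w D) n)
          (cong 𝟙 (does-⇔ admissible⇔hamp (admissible? (Des w D) 1 (zeros n)) (isHamp? (complement D) w)))
    where
    admissible⇔hamp : Admissible (Des w D) 1 (zeros {M} n) ⇔ IsHamp (complement D) w
    admissible⇔hamp =
      ⇔-sym (listing⇒hamp⇔consecutive (complement D) listing)
        ⇔-∘ subst (λ k → Admissible (Des w D) 1 (zeros {M} k) ⇔ Consecutive (complement D) w) len
                  (admissible-zeros⇔consecutive D 1 w)

  ζ-summand : {w : List (Fin n)} → length w ≡ n → (listing? : Dec (IsListing n w)) →
    (if does listing? then evalL (ℕ.suc M) (ζpoint M) (Des w D) n else + 0)
      ≡ 𝟙 (does (isHamp? (complement D) w))
  ζ-summand     len (yes listing) = evalL-ζpoint-Des listing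
  ζ-summand {w} len (no ¬listing) =
    sym (cong 𝟙 (dec-false (isHamp? (complement D) w) (¬listing ∘ hamp⇒listing _ len)))

lemma6p5 : (n : ℕ) (D : Digraph n) (m : ℕ) → ζU m D ≡ + numHamps (complement D)
lemma6p5 n D m = begin
  ζU m D
    ≡⟨ sumℤ-map-filter (isListing? n) (λ w → evalL (ℕ.suc m) (ζpoint m) (Des w D) n) Ws ⟩
  sumℤ (map (λ w → if does (isListing? n w) then evalL (ℕ.suc m) (ζpoint m) (Des w D) n else + 0) Ws)
    ≡⟨ sumℤ-map-cong (All.map (λ len → ζ-summand D m len (isListing? n _)) (length-listsOf (allFin n) n)) ⟩
  sumℤ (map (𝟙 ∘ does ∘ isHamp? D̄) Ws)
    ≡⟨ sumℤ-count (isHamp? D̄) Ws ⟩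
  + length (filter (isHamp? D̄) Ws)
    ≡⟨ cong +_ (sym (numHamps≡count D̄)) ⟩
  + numHamps D̄ ∎
  where
  D̄ : Digraph n
  D̄ = complement D
  Ws : List (List (Fin n))
  Ws = listsOf (allFin n) n
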